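{- For every finite forest $F$, $b_2(F) = \operatorname{bp}(F) = m(F)$.
   Context: For a finite simple graph $G=(V,E)$, a biclique on a subset of $V$ is given by two disjoint sets $X,Y\subseteq V$; its edges are all pairs $\{x,y\}$ with $x\in X$, $y\in Y$. An odd cover of $G$ is a collection of bicliques on subsets of $V$ such that every pair of vertices adjacent in $G$ is an edge of an odd number of the bicliques, and every pair of distinct non-adjacent vertices is an edge of an even number of the bicliques. $b_2(G)$ denotes the minimum cardinality of an odd cover of $G$. $\operatorname{bp}(G)$ is the minimum number of complete bipartite subgraphs of $G$ whose edge sets partition $E$. $m(G)$ is the maximum size of a matching in $G$. -}

module Defs where

open import Data.Nat using (ℕ; zero; suc; _+_; _≤_; _%_)
open import Data.Fin using (Fin; zero; suc; inject₁; fromℕ)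
open import Data.Bool using (Bool; true; false; _∧_; _∨_; if_then_else_)
open import Data.List using (List; []; _∷_; length; concatMap)
open import Data.List.Relation.Unary.All using (All)
open import Data.List.Relation.Unary.Any using (Any)
open import Data.List.Relation.Unary.Unique.Propositional using (Unique)
open import Data.Product using (Σ; ∃; ∃-syntax; _×_; _,_)
open import Relation.Binary.PropositionalEquality using (_≡_; _≢_)
open import Relation.Nullary using (¬_)
open import Function.Definitions using (Injective)

record Graph (n : ℕ) : Set where
  field
    adj    : Fin n → Fin n → Bool
    sym    : ∀ u v → adj u v ≡ adj v u
    irrefl : ∀ v → adj v v ≡ false
open Graph public

record Cycle {n : ℕ} (G : Graph n) : Set where
  field
    k     : ℕ
    vtx   : Fin (suc (suc (suc k))) → Fin n
    inj   : Injective _≡_ _≡_ vtx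
    step  : ∀ (i : Fin (suc (suc k))) → adj G (vtx (inject₁ i)) (vtx (suc i)) ≡ true
    close : adj G (vtx (fromℕ (suc (suc k)))) (vtx zero) ≡ true

IsForest : {n : ℕ} → Graph n → Set
IsForest G = ¬ Cycle G

record Biclique (n : ℕ) : Set where
  field
    X Y      : Fin n → Bool
    disjoint : ∀ v → X v ∧ Y v ≡ false
open Biclique public

bedge : {n : ℕ} → Biclique n → Fin n → Fin n → Bool
bedge B u v = (X B u ∧ Y B v) ∨ (Y B u ∧ X B v)

count : {n : ℕ} → List (Biclique n) → Fin n → Fin n → ℕ
count []       u v = 0
count (B ∷ Bs) u v = (if bedge B u v then 1 else 0) + count Bs u v

IsOddCover : {n : ℕ} → Graph n → List (Biclique n) → Set
IsOddCover G Bs = ∀ u v → u ≢ v →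
  (adj G u v ≡ true → count Bs u v % 2 ≡ 1) × (adj G u v ≡ false → count Bs u v % 2 ≡ 0)

IsB2 : {n : ℕ} → Graph n → ℕ → Set
IsB2 G k = (∃[ Bs ] (IsOddCover G Bs × length Bs ≡ k))
         × (∀ Bs → IsOddCover G Bs → k ≤ length Bs)

IsCompleteBipSubgraph : {n : ℕ} → Graph n → Biclique n → Set
IsCompleteBipSubgraph G B =
  (∃[ x ] X B x ≡ true) × (∃[ y ] Y B y ≡ true) ×
  (∀ x y → X B x ≡ true → Y B y ≡ true → adj G x y ≡ true)

IsBicliquePartition : {n : ℕ} → Graph n → List (Biclique n) → Set
IsBicliquePartition G Bs =
  All (IsCompleteBipSubgraph G) Bs ×
  (∀ u v → adj G u v ≡ true → count Bs u v ≡ 1)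

IsBp : {n : ℕ} → Graph n → ℕ → Set
IsBp G k = (∃[ Bs ] (IsBicliquePartition G Bs × length Bs ≡ k))
         × (∀ Bs → IsBicliquePartition G Bs → k ≤ length Bs)

endpoints : {n : ℕ} → List (Fin n × Fin n) → List (Fin n)
endpoints = concatMap (λ { (u , v) → u ∷ v ∷ [] })

IsMatching : {n : ℕ} → Graph n → List (Fin n × Fin n) → Set
IsMatching G M = All (λ { (u , v) → adj G u v ≡ true }) M × Unique (endpoints M)

IsMatchingNumber : {n : ℕ} → Graph n → ℕ → Set
IsMatchingNumber G k = (∃[ M ] (IsMatching G M × length M ≡ k))
                     × (∀ M → IsMatching G M → length M ≤ k)

-- Peel the forest: while a vertex set S still spans an edge, F[S] has a leaf v with neighbour u
-- (otherwise a non-backtracking walk inside S would close a cycle); record the edge vu and delete u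
-- and v.  The k recorded edges form a matching, so m ≥ k.  The stars centred at the vertices u
-- partition the edges, so bp ≤ k, and those vertices cover every edge, so m ≤ k.  Over GF(2) an odd
-- cover writes the adjacency matrix as a sum of forms x yᵀ + y xᵀ; eliminating the coordinate of each
-- recorded leaf in turn uses up one term and leaves a representation of the rest of the forest, so
-- b₂ ≥ k.  Finally b₂ ≤ bp, since a biclique partition is an odd cover.

module Submission where

open import Defs hiding (sym)
open import Algebra.Bundles using (CommutativeRing)
open import Data.Bool using (Bool; true; false; _∧_; _∨_; _xor_; if_then_else_)
open import Data.Bool.Properties
  using (∧-comm; ∧-zeroʳ; ∨-comm; xor-comm; xor-assoc; xor-same; xor-identityʳ; xor-∧-commutativeRing; ∧-distribˡ-xor; ∧-distribʳ-xor; ¬-not)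
  renaming (_≟_ to _≟ᵇ_)
open import Algebra.Properties.CommutativeSemigroup
  (CommutativeRing.+-commutativeSemigroup xor-∧-commutativeRing) using (interchange; x∙yz≈y∙xz)
open import Data.Fin using (Fin; zero; suc; toℕ; inject₁; fromℕ; _≟_)
open import Data.Fin.Properties using (any?; all?; ¬∀⟶∃¬; pigeonhole; toℕ-inject₁; toℕ-fromℕ; toℕ<n)
import Data.Fin.Properties as Fin
open import Data.Fin.Subset using (Subset; _∈_; _∉_; _⊆_; _-_; _∪_; ⁅_⁆; ∣_∣; ⊥; ⊤; outside; inside)
open import Data.Fin.Subset.Properties
  using (_∈?_; ∈⊤; p─q⊆p; ∣p─q∣≤∣p∣; ∣p∣≤∣x∷p∣; ∣⊥∣≡0; ∪-identityˡ; x∈⁅x⁆; x∈p∪q⁺; x∈p⇒∣p-x∣<∣p∣; x∈p∧x≢y⇒x∈p-y)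
open import Data.List using (List; []; _∷_; length; map)
open import Data.List.Properties using (length-map)
open import Data.List.Relation.Unary.All using (All; []; _∷_)
import Data.List.Relation.Unary.All as All
open import Data.List.Relation.Unary.AllPairs using ([]; _∷_)
open import Data.List.Relation.Unary.Unique.Propositional using (Unique)
open import Data.Nat using (ℕ; suc; _+_; _∸_; _≤_; _<_; z≤n; s≤s; _%_)
open import Data.Nat.DivMod using (%-distribˡ-+)
open import Data.Nat.GeneralisedArithmetic using (fold)
open import Data.Nat.Induction using (<-wellFounded)
open import Data.Nat.Properties
  using (≤-reflexive; ≤-trans; n<1+n; +-suc; +-comm; +-identityʳ; +-assoc; m+[n∸m]≡n; m<n⇒0<n∸m; m∸n≤m; <⇒≤; ≤-<-trans)
open import Data.Product using (∃; ∃₂; ∃-syntax; _×_; _,_; proj₁; proj₂)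
open import Data.Sum using (_⊎_; inj₁; inj₂; [_,_])
import Data.Sum as Sum
open import Data.Empty using (⊥-elim)
open import Data.Vec using (_∷_; there)
open import Function using (_∘_)
open import Induction.WellFounded using (Acc; acc)
open import Relation.Binary.Definitions using (DecidableEquality; tri<; tri≈; tri>)
open import Relation.Binary.PropositionalEquality using (_≡_; _≢_; refl; sym; trans; cong; cong₂; subst; module ≡-Reasoning)
open import Relation.Nullary using (¬_; Dec; yes; no; does; contradiction)
open import Relation.Nullary.Decidable using (dec-true; _×-dec_; _→-dec_)
import Relation.Nullary.Decidable as Dec

private
  variable
    n : ℕ

∧-≡true : ∀ {x y} → x ∧ y ≡ true → x ≡ true × y ≡ true
∧-≡true {true}  {true}  _ = refl , refl
∧-≡true {true}  {false} ()
∧-≡true {false}         ()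

∨-≡true : ∀ {x y} → x ∨ y ≡ true → x ≡ true ⊎ y ≡ true
∨-≡true {true}  _ = inj₁ refl
∨-≡true {false} e = inj₂ e

xor-cancelˡ : ∀ x y → x xor (x xor y) ≡ y
xor-cancelˡ x y = trans (sym (xor-assoc x x y)) (cong (_xor y) (xor-same x))

xor-cancel-middle : ∀ a b c d → (a xor b) xor ((b xor c) xor d) ≡ a xor (c xor d)
xor-cancel-middle a b c d = begin
  (a xor b) xor ((b xor c) xor d)  ≡⟨ xor-assoc a b _ ⟩
  a xor (b xor ((b xor c) xor d))  ≡⟨ cong (a xor_) (xor-assoc b (b xor c) d) ⟨
  a xor ((b xor (b xor c)) xor d)  ≡⟨ cong (λ t → a xor (t xor d)) (xor-cancelˡ b c) ⟩
  a xor (c xor d)                  ∎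
  where open ≡-Reasoning

¬→⇒×¬ : ∀ {p q} {P : Set p} {Q : Set q} → Dec P → ¬ (P → Q) → P × ¬ Q
¬→⇒×¬ (yes p) ¬[p→q] = p , λ q → ¬[p→q] λ _ → q
¬→⇒×¬ (no ¬p) ¬[p→q] = contradiction (λ p → contradiction p ¬p) ¬[p→q]

-- Alternating forms over GF(2)

Vector : ℕ → Set
Vector n = Fin n → Bool

_⊕_ : Vector n → Vector n → Vector n
(x ⊕ y) w = x w xor y w

-- The symmetric matrix x yᵀ + y xᵀ over GF(2); a biclique (X, Y) has the form wedge X Y.
wedge : Vector n → Vector n → Fin n → Fin n → Bool
wedge x y a b = (x a ∧ y b) xor (y a ∧ x b)

wedge-comm : ∀ (x y : Vector n) a b → wedge x y a b ≡ wedge y x a b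
wedge-comm x y a b = xor-comm (x a ∧ y b) (y a ∧ x b)

wedge-linearʳ : ∀ (x y z : Vector n) a b → wedge x (y ⊕ z) a b ≡ wedge x y a b xor wedge x z a b
wedge-linearʳ x y z a b = begin
  (x a ∧ (y b xor z b)) xor ((y a xor z a) ∧ x b)
    ≡⟨ cong₂ _xor_ (∧-distribˡ-xor (x a) (y b) (z b)) (∧-distribʳ-xor (x b) (y a) (z a)) ⟩
  ((x a ∧ y b) xor (x a ∧ z b)) xor ((y a ∧ x b) xor (z a ∧ x b))
    ≡⟨ interchange (x a ∧ y b) (x a ∧ z b) (y a ∧ x b) (z a ∧ x b) ⟩
  wedge x y a b xor wedge x z a b
    ∎
  where open ≡-Reasoning

wedge-linearˡ : ∀ (x y z : Vector n) a b → wedge (x ⊕ y) z a b ≡ wedge x z a b xor wedge y z a b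
wedge-linearˡ x y z a b = begin
  wedge (x ⊕ y) z a b              ≡⟨ wedge-comm (x ⊕ y) z a b ⟩
  wedge z (x ⊕ y) a b              ≡⟨ wedge-linearʳ z x y a b ⟩
  wedge z x a b xor wedge z y a b  ≡⟨ cong₂ _xor_ (wedge-comm z x a b) (wedge-comm z y a b) ⟩
  wedge x z a b xor wedge y z a b  ∎
  where open ≡-Reasoning

wedge-self : ∀ (x : Vector n) a b → wedge x x a b ≡ false
wedge-self x a b = xor-same (x a ∧ x b)

wedge-row : ∀ (x y : Vector n) {v} → x v ≡ true → y v ≡ false → ∀ w → wedge x y v w ≡ y w
wedge-row x y xv yv w rewrite xv | yv = xor-identityʳ (y w)

wedge-vanishes : ∀ (x : Vector n) {y : Vector n} {a b} → y a ≡ false → y b ≡ false → wedge x y a b ≡ false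
wedge-vanishes x {a = a} ya yb rewrite ya | yb | ∧-zeroʳ (x a) = refl

Σwedge : List (Vector n × Vector n) → Fin n → Fin n → Bool
Σwedge []             a b = false
Σwedge ((x , y) ∷ ps) a b = wedge x y a b xor Σwedge ps a b

VanishesAt : Fin n → Vector n × Vector n → Set
VanishesAt v (x , y) = x v ≡ false × y v ≡ false

Σwedge-vanishes : ∀ {v : Fin n} ps → All (VanishesAt v) ps → ∀ w → Σwedge ps v w ≡ false
Σwedge-vanishes []             []                 w = refl
Σwedge-vanishes ((x , y) ∷ ps) ((xv , yv) ∷ vanish) w rewrite xv | yv = Σwedge-vanishes ps vanish w

-- Gaussian elimination at the coordinate v: all terms but one can be made to vanish at v.
data Pivot (v : Fin n) (ps : List (Vector n × Vector n)) : Set where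
  vanishing : All (VanishesAt v) ps → Pivot v ps
  pivot     : ∀ x y qs → x v ≡ true → y v ≡ false → All (VanishesAt v) qs →
              length ps ≡ suc (length qs) →
              (∀ a b → Σwedge ps a b ≡ wedge x y a b xor Σwedge qs a b) → Pivot v ps

data Normalised (v : Fin n) (x y : Vector n) : Set where
  vanishing : VanishesAt v (x , y) → Normalised v x y
  normalised : ∀ x′ y′ → x′ v ≡ true → y′ v ≡ false →
               (∀ a b → wedge x y a b ≡ wedge x′ y′ a b) → Normalised v x y

normalise : ∀ v (x y : Vector n) → Normalised v x y
normalise v x y with x v in xv | y v in yv
... | false | false = vanishing (xv , yv)
... | true  | false = normalised x y xv yv λ _ _ → refl
... | false | true  = normalised y x yv xv (wedge-comm x y)
... | true  | true  = normalised x (y ⊕ x) xv (cong₂ _xor_ yv xv) λ a b → sym (begin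
      wedge x (y ⊕ x) a b              ≡⟨ wedge-linearʳ x y x a b ⟩
      wedge x y a b xor wedge x x a b  ≡⟨ cong (wedge x y a b xor_) (wedge-self x a b) ⟩
      wedge x y a b xor false          ≡⟨ xor-identityʳ _ ⟩
      wedge x y a b                    ∎)
  where open ≡-Reasoning

pivot-at : ∀ (v : Fin n) ps → Pivot v ps
pivot-at v [] = vanishing []
pivot-at v ((x , y) ∷ ps) with normalise v x y | pivot-at v ps
... | vanishing z | vanishing zs = vanishing (z ∷ zs)
... | vanishing z | pivot x₂ y₂ qs x₂v y₂v zs len split =
  pivot x₂ y₂ ((x , y) ∷ qs) x₂v y₂v (z ∷ zs) (cong suc len) λ a b →
    trans (cong (wedge x y a b xor_) (split a b)) (x∙yz≈y∙xz (wedge x y a b) (wedge x₂ y₂ a b) (Σwedge qs a b))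
... | normalised x₁ y₁ x₁v y₁v same | vanishing zs =
  pivot x₁ y₁ ps x₁v y₁v zs refl λ a b → cong (_xor Σwedge ps a b) (same a b)
... | normalised x₁ y₁ x₁v y₁v same | pivot x₂ y₂ qs x₂v y₂v zs len split =
  pivot x₁ (y₁ ⊕ y₂) ((x₁ ⊕ x₂ , y₂) ∷ qs) x₁v (cong₂ _xor_ y₁v y₂v)
        ((cong₂ _xor_ x₁v x₂v , y₂v) ∷ zs) (cong suc len) merged
  where
    open ≡-Reasoning
    -- the cross terms wedge x₁ y₂ produced by the two substitutions cancel
    merged : ∀ a b → wedge x y a b xor Σwedge ps a b
                   ≡ wedge x₁ (y₁ ⊕ y₂) a b xor (wedge (x₁ ⊕ x₂) y₂ a b xor Σwedge qs a b)
    merged a b = begin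
      wedge x y a b xor Σwedge ps a b
        ≡⟨ cong₂ _xor_ (same a b) (split a b) ⟩
      w₁₁ xor (w₂₂ xor Σwedge qs a b)
        ≡⟨ xor-cancel-middle w₁₁ w₁₂ w₂₂ (Σwedge qs a b) ⟨
      (w₁₁ xor w₁₂) xor ((w₁₂ xor w₂₂) xor Σwedge qs a b)
        ≡⟨ cong₂ (λ s t → s xor (t xor Σwedge qs a b))
                 (wedge-linearʳ x₁ y₁ y₂ a b) (wedge-linearˡ x₁ x₂ y₂ a b) ⟨
      wedge x₁ (y₁ ⊕ y₂) a b xor (wedge (x₁ ⊕ x₂) y₂ a b xor Σwedge qs a b)
        ∎
      where
        w₁₁ w₁₂ w₂₂ : Bool
        w₁₁ = wedge x₁ y₁ a b
        w₁₂ = wedge x₁ y₂ a b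
        w₂₂ = wedge x₂ y₂ a b

sides : Biclique n → Vector n × Vector n
sides B = X B , Y B

bedge-sym : ∀ (B : Biclique n) a b → bedge B a b ≡ bedge B b a
bedge-sym B a b = trans (∨-comm (X B a ∧ Y B b) (Y B a ∧ X B b))
                        (cong₂ _∨_ (∧-comm (Y B a) (X B b)) (∧-comm (X B a) (Y B b)))

bedge≡wedge : ∀ (B : Biclique n) a b → bedge B a b ≡ wedge (X B) (Y B) a b
bedge≡wedge B a b = disjoint-∨ (X B a) (Y B b) (Y B a) (X B b) (disjoint B a)
  where
    disjoint-∨ : ∀ p q r s → p ∧ r ≡ false → (p ∧ q) ∨ (r ∧ s) ≡ (p ∧ q) xor (r ∧ s)
    disjoint-∨ true  true  false s _ = refl
    disjoint-∨ true  false false s _ = refl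
    disjoint-∨ false q     r     s _ = refl

count-parity : ∀ (Bs : List (Biclique n)) a b →
               count Bs a b % 2 ≡ (if Σwedge (map sides Bs) a b then 1 else 0)
count-parity []       a b = refl
count-parity (B ∷ Bs) a b rewrite bedge≡wedge B a b =
  parity-step (wedge (X B) (Y B) a b) (Σwedge (map sides Bs) a b) (count-parity Bs a b)
  where
    parity-step : ∀ c d {m} → m % 2 ≡ (if d then 1 else 0) →
                  ((if c then 1 else 0) + m) % 2 ≡ (if c xor d then 1 else 0)
    parity-step false d     m%2 = m%2
    parity-step true  false {m} m%2 = trans (%-distribˡ-+ 1 m 2) (cong (λ r → (1 + r) % 2) m%2)
    parity-step true  true  {m} m%2 = trans (%-distribˡ-+ 1 m 2) (cong (λ r → (1 + r) % 2) m%2)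

oddCover⇒Σwedge≡adj : ∀ (G : Graph n) Bs → IsOddCover G Bs →
                      ∀ a b → a ≢ b → Σwedge (map sides Bs) a b ≡ adj G a b
oddCover⇒Σwedge≡adj G Bs odd a b a≢b
  with adj G a b in ab | Σwedge (map sides Bs) a b | count-parity Bs a b
... | true  | true  | _ = refl
... | false | false | _ = refl
... | true  | false | parity = contradiction (trans (sym parity) (proj₁ (odd a b a≢b) ab)) λ ()
... | false | true  | parity = contradiction (trans (sym parity) (proj₂ (odd a b a≢b) ab)) λ ()

complete-bedge : ∀ (G : Graph n) B → IsCompleteBipSubgraph G B →
                 ∀ {a b} → bedge B a b ≡ true → adj G a b ≡ true
complete-bedge G B (_ , _ , complete) {a} {b} e with ∨-≡true e
... | inj₁ ab = let xa , yb = ∧-≡true ab in complete a b xa yb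
... | inj₂ ba = let ya , xb = ∧-≡true ba in trans (Graph.sym G a b) (complete b a xb ya)

count-nonadjacent : ∀ (G : Graph n) {Bs} → All (IsCompleteBipSubgraph G) Bs →
                    ∀ {a b} → adj G a b ≡ false → count Bs a b ≡ 0
count-nonadjacent G []                   ab = refl
count-nonadjacent G {B ∷ _} (complete ∷ cs) {a} {b} ab with bedge B a b in e
... | true  = contradiction (trans (sym ab) (complete-bedge G B complete e)) λ ()
... | false = count-nonadjacent G cs ab

partition⇒oddCover : ∀ (G : Graph n) {Bs} → IsBicliquePartition G Bs → IsOddCover G Bs
partition⇒oddCover G (complete , once) a b _ =
  (λ ab → cong (_% 2) (once a b ab)) , (λ ab → cong (_% 2) (count-nonadjacent G complete ab))

x∉p-x : ∀ {x : Fin n} (p : Subset n) → x ∉ p - x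
x∉p-x {x = zero}  (s ∷ p) ()
x∉p-x {x = suc x} (s ∷ p) (there x∈p-x) = x∉p-x p x∈p-x

p-x-y⊆p : ∀ {p : Subset n} {x y} → p - x - y ⊆ p
p-x-y⊆p {p = p} {x} {y} = p─q⊆p p ⁅ x ⁆ ∘ p─q⊆p (p - x) ⁅ y ⁆

x∉p-x-y : ∀ {p : Subset n} {x y} → x ∉ p - x - y
x∉p-x-y {p = p} {x} {y} = x∉p-x p ∘ p─q⊆p (p - x) ⁅ y ⁆

y∉p-x-y : ∀ {p : Subset n} {x y} → y ∉ p - x - y
y∉p-x-y {p = p} {x} = x∉p-x (p - x)

x∈p∧x≢y∧x≢z⇒x∈p-y-z : ∀ {p : Subset n} {x y z} → x ∈ p → x ≢ y → x ≢ z → x ∈ p - y - z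
x∈p∧x≢y∧x≢z⇒x∈p-y-z x∈p x≢y x≢z = x∈p∧x≢y⇒x∈p-y (x∈p∧x≢y⇒x∈p-y x∈p x≢y) x≢z

x∈p⇒∣p-x-y∣<∣p∣ : ∀ {p : Subset n} {x} y → x ∈ p → ∣ p - x - y ∣ < ∣ p ∣
x∈p⇒∣p-x-y∣<∣p∣ {p = p} {x} y x∈p = ≤-<-trans (∣p─q∣≤∣p∣ (p - x) ⁅ y ⁆) (x∈p⇒∣p-x∣<∣p∣ x∈p)

∣⁅x⁆∪p∣≤1+∣p∣ : ∀ (x : Fin n) p → ∣ ⁅ x ⁆ ∪ p ∣ ≤ suc ∣ p ∣
∣⁅x⁆∪p∣≤1+∣p∣ zero    (s ∷ p)       rewrite ∪-identityˡ p = s≤s (∣p∣≤∣x∷p∣ s p)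
∣⁅x⁆∪p∣≤1+∣p∣ (suc x) (inside  ∷ p) = s≤s (∣⁅x⁆∪p∣≤1+∣p∣ x p)
∣⁅x⁆∪p∣≤1+∣p∣ (suc x) (outside ∷ p) = ∣⁅x⁆∪p∣≤1+∣p∣ x p

module _ {a} {A : Set a} (_≟ₐ_ : DecidableEquality A) (f : ℕ → A) where

  InjectiveOn : ℕ → ℕ → Set a
  InjectiveOn i m = ∀ (j k : Fin m) → f (i + toℕ j) ≡ f (i + toℕ k) → j ≡ k

  record Loop : Set a where
    field
      start period : ℕ
      positive     : 0 < period
      closed       : f start ≡ f (start + period)
      simple       : InjectiveOn start period

  injectiveAt? : ∀ i {m} (j k : Fin m) → Dec (f (i + toℕ j) ≡ f (i + toℕ k) → j ≡ k)
  injectiveAt? i j k = (f (i + toℕ j) ≟ₐ f (i + toℕ k)) →-dec (j ≟ k)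

  injectiveOn? : ∀ i m → Dec (InjectiveOn i m)
  injectiveOn? i m = all? λ j → all? (injectiveAt? i j)

  collision : ∀ {i m} → ¬ InjectiveOn i m →
              ∃₂ λ (j k : Fin m) → toℕ j < toℕ k × f (i + toℕ j) ≡ f (i + toℕ k)
  collision {i} {m} ¬simple
    with j , ¬simpleʲ ← ¬∀⟶∃¬ m _ (λ j → all? (injectiveAt? i j)) ¬simple
    with k , ¬[≡→≡] ← ¬∀⟶∃¬ m _ (injectiveAt? i j) ¬simpleʲ
    with fj≡fk , j≢k ← ¬→⇒×¬ (f (i + toℕ j) ≟ₐ f (i + toℕ k)) ¬[≡→≡]
    with Fin.<-cmp j k
  ... | tri< j<k _ _ = j , k , j<k , fj≡fk
  ... | tri≈ _ j≡k _ = contradiction j≡k j≢k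
  ... | tri> _ _ k<j = k , j , k<j , sym fj≡fk

  repeat⇒loop : ∀ {m} → Acc _<_ m → ∀ i → 0 < m → f i ≡ f (i + m) → Loop
  repeat⇒loop {m} (acc shorter) i positive closed with injectiveOn? i m
  ... | yes simple = record { start = i ; period = m ; positive = positive ; closed = closed ; simple = simple }
  ... | no ¬simple with j , k , j<k , fj≡fk ← collision ¬simple =
    repeat⇒loop (shorter (≤-<-trans (m∸n≤m (toℕ k) (toℕ j)) (toℕ<n k)))
                (i + toℕ j) (m<n⇒0<n∸m j<k) closed′
    where
      closed′ : f (i + toℕ j) ≡ f (i + toℕ j + (toℕ k ∸ toℕ j))
      closed′ rewrite +-assoc i (toℕ j) (toℕ k ∸ toℕ j) | m+[n∸m]≡n (<⇒≤ j<k) = fj≡fk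

finite-loop : ∀ (f : ℕ → Fin n) → Loop _≟_ f
finite-loop {n} f with i , j , i<j , fi≡fj ← pigeonhole (n<1+n n) (f ∘ toℕ) =
  repeat⇒loop _≟_ f (<-wellFounded _) (toℕ i) (m<n⇒0<n∸m i<j)
              (trans fi≡fj (cong f (sym (m+[n∸m]≡n (<⇒≤ i<j)))))

-- Non-backtracking walks

module _ (F : Graph n) where

  adjacent⇒≢ : ∀ {a b} → adj F a b ≡ true → a ≢ b
  adjacent⇒≢ {a} ab refl = contradiction (trans (sym ab) (irrefl F a)) λ ()

  record NonBacktrackingWalk : Set where
    field
      vertex          : ℕ → Fin n
      adjacent        : ∀ t → adj F (vertex t) (vertex (suc t)) ≡ true
      nonbacktracking : ∀ t → vertex (suc (suc t)) ≢ vertex t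

  walk⇒cycle : NonBacktrackingWalk → Cycle F
  walk⇒cycle walk = loop⇒cycle (finite-loop vertex)
    where
      open NonBacktrackingWalk walk

      loop⇒cycle : Loop _≟_ vertex → Cycle F
      loop⇒cycle record { start = i ; period = 1 ; closed = closed } =
        ⊥-elim (adjacent⇒≢ (adjacent i) (trans closed (cong vertex (+-comm i 1))))
      loop⇒cycle record { start = i ; period = 2 ; closed = closed } =
        ⊥-elim (nonbacktracking i (sym (trans closed (cong vertex (+-comm i 2)))))
      loop⇒cycle record { start = i ; period = suc (suc (suc k)) ; closed = closed ; simple = simple } =
        record { k = k ; vtx = λ t → vertex (i + toℕ t) ; inj = simple _ _ ; step = step ; close = close }
        where
          step : ∀ t → adj F (vertex (i + toℕ (inject₁ t))) (vertex (i + suc (toℕ t))) ≡ true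
          step t rewrite toℕ-inject₁ t | +-suc i (toℕ t) = adjacent (i + toℕ t)
          close : adj F (vertex (i + toℕ (fromℕ (suc (suc k))))) (vertex (i + 0)) ≡ true
          close rewrite toℕ-fromℕ (suc (suc k)) | +-identityʳ i =
            subst (λ w → adj F (vertex (i + suc (suc k))) w ≡ true)
                  (sym (trans closed (cong vertex (+-suc i (suc (suc k))))))
                  (adjacent (i + suc (suc k)))

  record Arc (S : Subset n) : Set where
    constructor arc
    field
      {tail head} : Fin n
      tail∈S      : tail ∈ S
      head∈S      : head ∈ S
      edge        : adj F tail head ≡ true

  NoPendant : Subset n → Set
  NoPendant S = (e : Arc S) → ∃[ w ] w ∈ S × adj F (Arc.head e) w ≡ true × w ≢ Arc.tail e

  nonbacktracking-walk : ∀ {S} → NoPendant S → Arc S → NonBacktrackingWalk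
  nonbacktracking-walk {S} continue start = record
    { vertex          = Arc.head ∘ arcs
    ; adjacent        = Arc.edge ∘ arcs ∘ suc
    ; nonbacktracking = λ t → proj₂ (proj₂ (proj₂ (continue (arcs (suc t)))))
    }
    where
      next : Arc S → Arc S
      next e = arc (Arc.head∈S e) (proj₁ (proj₂ (continue e))) (proj₁ (proj₂ (proj₂ (continue e))))
      arcs : ℕ → Arc S
      arcs = fold start next

  VertexCover : Subset n → Set
  VertexCover C = ∀ {a b} → adj F a b ≡ true → a ∈ C ⊎ b ∈ C

  Covered : Subset n → Fin n × Fin n → Set
  Covered C (a , b) = a ∈ C ⊎ b ∈ C

  covered-without : ∀ {C c} M → All (c ≢_) (endpoints M) → All (Covered C) M → All (Covered (C - c)) M
  covered-without [] [] [] = []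
  covered-without ((a , b) ∷ M) (c≢a ∷ c≢b ∷ c∉M) (a∈C⊎b∈C ∷ covered) =
    Sum.map (λ a∈C → x∈p∧x≢y⇒x∈p-y a∈C (c≢a ∘ sym)) (λ b∈C → x∈p∧x≢y⇒x∈p-y b∈C (c≢b ∘ sym)) a∈C⊎b∈C
    ∷ covered-without M c∉M covered

  disjoint-matching≤∣cover∣ : ∀ {C} M → All (Covered C) M → Unique (endpoints M) → length M ≤ ∣ C ∣
  disjoint-matching≤∣cover∣ [] _ _ = z≤n
  disjoint-matching≤∣cover∣ ((a , b) ∷ M) (inj₁ a∈C ∷ covered) ((_ ∷ a∉M) ∷ _ ∷ unique) =
    ≤-<-trans (disjoint-matching≤∣cover∣ M (covered-without M a∉M covered) unique) (x∈p⇒∣p-x∣<∣p∣ a∈C)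
  disjoint-matching≤∣cover∣ ((a , b) ∷ M) (inj₂ b∈C ∷ covered) (_ ∷ b∉M ∷ unique) =
    ≤-<-trans (disjoint-matching≤∣cover∣ M (covered-without M b∉M covered) unique) (x∈p⇒∣p-x∣<∣p∣ b∈C)

  matching≤∣cover∣ : ∀ {C M} → VertexCover C → IsMatching F M → length M ≤ ∣ C ∣
  matching≤∣cover∣ {M = M} cover (adjacent , unique) =
    disjoint-matching≤∣cover∣ M (All.map (λ { {_ , _} ab → cover ab }) adjacent) unique

  -- Peeling pendant edges

  Edgeless : Subset n → Set
  Edgeless S = ∀ {a b} → a ∈ S → b ∈ S → adj F a b ≡ false

  Pendant : Subset n → Fin n → Fin n → Set
  Pendant S v u = v ∈ S × u ∈ S × adj F v u ≡ true × (∀ w → w ∈ S → adj F v w ≡ true → w ≡ u)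

  arc? : ∀ S → Dec (Arc S)
  arc? S = Dec.map′ (λ (a , b , a∈ , b∈ , ab) → arc a∈ b∈ ab) (λ (arc a∈ b∈ ab) → _ , _ , a∈ , b∈ , ab)
    (any? λ a → any? λ b → (a ∈? S) ×-dec (b ∈? S) ×-dec (adj F a b ≟ᵇ true))

  pendant? : ∀ S → Dec (∃₂ (Pendant S))
  pendant? S = any? λ v → any? λ u → (v ∈? S) ×-dec (u ∈? S) ×-dec (adj F v u ≟ᵇ true) ×-dec
                 all? λ w → (w ∈? S) →-dec ((adj F v w ≟ᵇ true) →-dec (w ≟ u))

  ¬pendant⇒noPendant : ∀ {S} → ¬ ∃₂ (Pendant S) → NoPendant S
  ¬pendant⇒noPendant {S} ¬pendant (arc {c} {d} c∈S d∈S cd)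
    with w , ¬unique ← ¬∀⟶∃¬ n _ (λ w → (w ∈? S) →-dec ((adj F d w ≟ᵇ true) →-dec (w ≟ c)))
                                 (λ unique → ¬pendant (d , c , d∈S , c∈S , trans (Graph.sym F d c) cd , unique))
    with w∈S , ¬[dw→w≡c] ← ¬→⇒×¬ (w ∈? S) ¬unique
    with dw , w≢c ← ¬→⇒×¬ (adj F d w ≟ᵇ true) ¬[dw→w≡c]
    = w , w∈S , dw , w≢c

  pendant-or-edgeless : IsForest F → ∀ S → ∃₂ (Pendant S) ⊎ Edgeless S
  pendant-or-edgeless forest S with pendant? S | arc? S
  ... | yes pendant | _       = inj₁ pendant
  ... | no ¬pendant | yes e   = contradiction (walk⇒cycle (nonbacktracking-walk (¬pendant⇒noPendant ¬pendant) e)) forest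
  ... | no _        | no ¬arc = inj₂ λ a∈ b∈ → ¬-not λ ab → ¬arc (arc a∈ b∈ ab)

  data Peeling : Subset n → List (Fin n × Fin n) → Set where
    edgeless : ∀ {S} → Edgeless S → Peeling S []
    peel     : ∀ {S v u L} → Pendant S v u → Peeling (S - u - v) L → Peeling S ((v , u) ∷ L)

  peeling-exists : IsForest F → ∀ S → ∃ (Peeling S)
  peeling-exists forest S = go S (<-wellFounded ∣ S ∣)
    where
      go : ∀ S → Acc _<_ ∣ S ∣ → ∃ (Peeling S)
      go S (acc smaller) with pendant-or-edgeless forest S
      ... | inj₂ none = [] , edgeless none
      ... | inj₁ (v , u , pendant@(_ , u∈S , _)) =
        let L , p = go (S - u - v) (smaller (x∈p⇒∣p-x-y∣<∣p∣ v u∈S)) in (v , u) ∷ L , peel pendant p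

  edge-survives-peel : ∀ {S v u a b} → Pendant S v u → a ∈ S → b ∈ S → adj F a b ≡ true →
                       a ≢ u → b ≢ u → a ∈ S - u - v × b ∈ S - u - v
  edge-survives-peel {v = v} {a = a} {b} (_ , _ , _ , unique) a∈S b∈S ab a≢u b≢u =
    x∈p∧x≢y∧x≢z⇒x∈p-y-z a∈S a≢u a≢v , x∈p∧x≢y∧x≢z⇒x∈p-y-z b∈S b≢u b≢v
    where
      a≢v : a ≢ v
      a≢v refl = b≢u (unique b b∈S ab)
      b≢v : b ≢ v
      b≢v refl = a≢u (unique a a∈S (trans (Graph.sym F b a) ab))

  peeling-matching : ∀ {S L} → Peeling S L → IsMatching F L × All (_∈ S) (endpoints L)
  peeling-matching (edgeless _) = ([] , []) , []
  peeling-matching (peel (v∈S , u∈S , vu , _) p) with peeling-matching p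
  ... | (adjacent , unique) , endpoints∈ =
    (vu ∷ adjacent ,
     (adjacent⇒≢ vu ∷ All.map (λ w∈ v≡w → y∉p-x-y (subst (_∈ _) (sym v≡w) w∈)) endpoints∈)
     ∷ All.map (λ w∈ u≡w → x∉p-x-y (subst (_∈ _) (sym u≡w) w∈)) endpoints∈ ∷ unique) ,
    v∈S ∷ u∈S ∷ All.map p-x-y⊆p endpoints∈

  star : Subset n → Fin n → Biclique n
  star S u = record
    { X        = λ w → does (w ≟ u)
    ; Y        = λ w → does (w ∈? S) ∧ adj F u w
    ; disjoint = disjoint′
    }
    where
      disjoint′ : ∀ w → does (w ≟ u) ∧ (does (w ∈? S) ∧ adj F u w) ≡ false
      disjoint′ w with w ≟ u
      ... | no _     = refl
      ... | yes refl rewrite irrefl F w = ∧-zeroʳ (does (w ∈? S))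

  StarEdge : Subset n → Fin n → Fin n → Fin n → Set
  StarEdge S u a b = a ≡ u × b ∈ S × adj F u b ≡ true

  star-edge⁺ : ∀ {S u a b} → StarEdge S u a b → bedge (star S u) a b ≡ true
  star-edge⁺ {S} {u} {b = b} (refl , b∈S , ub)
    rewrite dec-true (u ≟ u) refl | dec-true (b ∈? S) b∈S | ub = refl

  star-half-edge : ∀ {S u a b} → does (a ≟ u) ∧ (does (b ∈? S) ∧ adj F u b) ≡ true → StarEdge S u a b
  star-half-edge {S} {u} {a} {b} e with a ≟ u | b ∈? S | adj F u b
  ... | yes a≡u | yes b∈S | true  = a≡u , b∈S , refl
  star-half-edge () | yes _ | yes _ | false
  star-half-edge () | yes _ | no _  | _
  star-half-edge () | no _  | _     | _

  star-edge⁻ : ∀ {S u a b} → bedge (star S u) a b ≡ true → StarEdge S u a b ⊎ StarEdge S u b a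
  star-edge⁻ {S} {u} {a} {b} e with ∨-≡true e
  ... | inj₁ ab = inj₁ (star-half-edge ab)
  ... | inj₂ ba = inj₂ (star-half-edge (trans (∧-comm (does (b ≟ u)) _) ba))

  star-edge-centre : ∀ {S u a b} → bedge (star S u) a b ≡ true → a ≡ u ⊎ b ≡ u
  star-edge-centre {S} {u} {a} {b} e = Sum.map proj₁ proj₁ (star-edge⁻ {S} {u} {a} {b} e)

  star-edge-inside : ∀ {S u a b} → u ∈ S → bedge (star S u) a b ≡ true → a ∈ S × b ∈ S
  star-edge-inside {S} {u} {a} {b} u∈S e with star-edge⁻ {S} {u} {a} {b} e
  ... | inj₁ (refl , b∈S , _) = u∈S , b∈S
  ... | inj₂ (refl , a∈S , _) = a∈S , u∈S

  stars : ∀ {S L} → Peeling S L → List (Biclique n)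
  stars (edgeless _)                 = []
  stars {S} (peel {u = u} _ p) = star S u ∷ stars p

  length-stars : ∀ {S L} (p : Peeling S L) → length (stars p) ≡ length L
  length-stars (edgeless _) = refl
  length-stars (peel _ p)   = cong suc (length-stars p)

  stars-complete : ∀ {S L} (p : Peeling S L) → All (IsCompleteBipSubgraph F) (stars p)
  stars-complete (edgeless _) = []
  stars-complete {S} (peel {v = v} {u} (v∈S , _ , vu , _) p) =
    ((u , dec-true (u ≟ u) refl) , (v , uv) , complete) ∷ stars-complete p
    where
      uv : does (v ∈? S) ∧ adj F u v ≡ true
      uv rewrite dec-true (v ∈? S) v∈S = trans (Graph.sym F u v) vu
      complete : ∀ x y → does (x ≟ u) ≡ true → does (y ∈? S) ∧ adj F u y ≡ true → adj F x y ≡ true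
      complete x y xu yu with star-half-edge {S} {u} {x} {y} (cong₂ _∧_ xu yu)
      ... | refl , _ , uy = uy

  count-stars-outside : ∀ {S L} (p : Peeling S L) {a b} → ¬ (a ∈ S × b ∈ S) → count (stars p) a b ≡ 0
  count-stars-outside (edgeless _) _ = refl
  count-stars-outside {S} (peel {u = u} (_ , u∈S , _) p) {a} {b} ¬both with bedge (star S u) a b in e
  ... | true  = contradiction (star-edge-inside u∈S e) ¬both
  ... | false = count-stars-outside p λ (a∈ , b∈) → ¬both (p-x-y⊆p a∈ , p-x-y⊆p b∈)

  count-stars-edge : ∀ {S L} (p : Peeling S L) {a b} → a ∈ S → b ∈ S → adj F a b ≡ true →
                     count (stars p) a b ≡ 1
  count-stars-edge (edgeless none) a∈S b∈S ab = contradiction (trans (sym (none a∈S b∈S)) ab) λ ()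
  count-stars-edge {S} (peel {u = u} pendant p) {a} {b} a∈S b∈S ab with bedge (star S u) a b in e
  ... | true  = cong suc (count-stars-outside p λ (a∈ , b∈) →
                  [ (λ a≡u → x∉p-x-y (subst (_∈ _) a≡u a∈)) , (λ b≡u → x∉p-x-y (subst (_∈ _) b≡u b∈)) ]
                  (star-edge-centre e))
  ... | false = let a∈′ , b∈′ = edge-survives-peel pendant a∈S b∈S ab a≢u b≢u in count-stars-edge p a∈′ b∈′ ab
    where
      a≢u : a ≢ u
      a≢u refl = contradiction (trans (sym e) (star-edge⁺ (refl , b∈S , ab))) λ ()
      b≢u : b ≢ u
      b≢u refl = contradiction (trans (sym e) (trans (bedge-sym (star S u) a b)
                                 (star-edge⁺ (refl , a∈S , trans (Graph.sym F b a) ab)))) λ ()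

  stars-partition : ∀ {L} (p : Peeling ⊤ L) → IsBicliquePartition F (stars p)
  stars-partition p = stars-complete p , λ a b ab → count-stars-edge p ∈⊤ ∈⊤ ab

  peeling-cover : ∀ {S L} → Peeling S L → Subset n
  peeling-cover (edgeless _)       = ⊥
  peeling-cover (peel {u = u} _ p) = ⁅ u ⁆ ∪ peeling-cover p

  ∣peeling-cover∣≤length : ∀ {S L} (p : Peeling S L) → ∣ peeling-cover p ∣ ≤ length L
  ∣peeling-cover∣≤length (edgeless _)       = ≤-reflexive (∣⊥∣≡0 n)
  ∣peeling-cover∣≤length (peel {u = u} _ p) =
    ≤-trans (∣⁅x⁆∪p∣≤1+∣p∣ u (peeling-cover p)) (s≤s (∣peeling-cover∣≤length p))

  peeling-cover-covers : ∀ {S L} (p : Peeling S L) {a b} → a ∈ S → b ∈ S → adj F a b ≡ true →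
                         a ∈ peeling-cover p ⊎ b ∈ peeling-cover p
  peeling-cover-covers (edgeless none) a∈S b∈S ab = contradiction (trans (sym (none a∈S b∈S)) ab) λ ()
  peeling-cover-covers (peel {u = u} pendant p) {a} {b} a∈S b∈S ab with a ≟ u | b ≟ u
  ... | yes refl | _        = inj₁ (x∈p∪q⁺ (inj₁ (x∈⁅x⁆ a)))
  ... | no _     | yes refl = inj₂ (x∈p∪q⁺ (inj₁ (x∈⁅x⁆ b)))
  ... | no a≢u   | no b≢u   =
    let a∈′ , b∈′ = edge-survives-peel pendant a∈S b∈S ab a≢u b≢u
    in Sum.map (x∈p∪q⁺ ∘ inj₂) (x∈p∪q⁺ ∘ inj₂) (peeling-cover-covers p a∈′ b∈′ ab)

  matching≤peeling : ∀ {L M} (p : Peeling ⊤ L) → IsMatching F M → length M ≤ length L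
  matching≤peeling p matching =
    ≤-trans (matching≤∣cover∣ (peeling-cover-covers p ∈⊤ ∈⊤) matching) (∣peeling-cover∣≤length p)

  Σwedge-rank : ∀ {S L} → Peeling S L → ∀ ps →
                (∀ {a b} → a ∈ S → b ∈ S → a ≢ b → Σwedge ps a b ≡ adj F a b) → length L ≤ length ps
  Σwedge-rank (edgeless _) ps _ = z≤n
  Σwedge-rank {S} (peel {v = v} {u} (v∈S , u∈S , vu , unique) p) ps represents with pivot-at v ps
  ... | vanishing zs =
    contradiction (trans (sym (Σwedge-vanishes ps zs u)) (trans (represents v∈S u∈S (adjacent⇒≢ vu)) vu)) λ ()
  ... | pivot x y qs xv yv zs len split =
    subst (_ ≤_) (sym len) (s≤s (Σwedge-rank p qs represents′))
    where
      open ≡-Reasoning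

      row-v : ∀ w → Σwedge ps v w ≡ y w
      row-v w = begin
        Σwedge ps v w                      ≡⟨ split v w ⟩
        wedge x y v w xor Σwedge qs v w    ≡⟨ cong₂ _xor_ (wedge-row x y xv yv w) (Σwedge-vanishes qs zs w) ⟩
        y w xor false                      ≡⟨ xor-identityʳ (y w) ⟩
        y w                                ∎

      y-vanishes : ∀ {w} → w ∈ S - u - v → y w ≡ false
      y-vanishes {w} w∈ with adj F v w in vw
      ... | true  = contradiction (subst (_∈ S - u - v) (unique w (p-x-y⊆p w∈) vw) w∈) x∉p-x-y
      ... | false = begin
        y w            ≡⟨ sym (row-v w) ⟩
        Σwedge ps v w  ≡⟨ represents v∈S (p-x-y⊆p w∈) (λ v≡w → y∉p-x-y (subst (_∈ S - u - v) (sym v≡w) w∈)) ⟩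
        adj F v w      ≡⟨ vw ⟩
        false          ∎

      represents′ : ∀ {a b} → a ∈ S - u - v → b ∈ S - u - v → a ≢ b → Σwedge qs a b ≡ adj F a b
      represents′ {a} {b} a∈ b∈ a≢b = begin
        Σwedge qs a b                    ≡⟨ cong (_xor Σwedge qs a b) (wedge-vanishes x (y-vanishes a∈) (y-vanishes b∈)) ⟨
        wedge x y a b xor Σwedge qs a b  ≡⟨ split a b ⟨
        Σwedge ps a b                    ≡⟨ represents (p-x-y⊆p a∈) (p-x-y⊆p b∈) a≢b ⟩
        adj F a b                        ∎

  oddCover-size : ∀ {L} → Peeling ⊤ L → ∀ Bs → IsOddCover F Bs → length L ≤ length Bs
  oddCover-size p Bs odd = subst (_ ≤_) (length-map sides Bs)
    (Σwedge-rank p (map sides Bs) λ {a} {b} _ _ → oddCover⇒Σwedge≡adj F Bs odd a b)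

proposition4p2 : ∀ (n : ℕ) (F : Graph n) → IsForest F →
    ∃[ k ] (IsB2 F k × IsBp F k × IsMatchingNumber F k)
proposition4p2 n F forest with L , p ← peeling-exists F forest ⊤ =
  length L , b₂ , bp , m
  where
    partition : IsBicliquePartition F (stars F p)
    partition = stars-partition F p
    b₂ : IsB2 F (length L)
    b₂ = (stars F p , partition⇒oddCover F partition , length-stars F p) , oddCover-size F p
    bp : IsBp F (length L)
    bp = (stars F p , partition , length-stars F p) , λ Bs → oddCover-size F p Bs ∘ partition⇒oddCover F
    m : IsMatchingNumber F (length L)
    m = (L , proj₁ (peeling-matching F p) , refl) , λ _ → matching≤peeling F p
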